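{- Let $\Gamma$ be a graph of size $e$ and let $d$ be a positive divisor of $e$. If $\Gamma$ admits a $d$-graceful labeling, then there exists a cyclic $\Gamma$-decomposition of the complete multipartite graph $K_{(\frac{e}{d}+1)\times 2d}$.
   Context: For a graph $\Gamma$ of size $e$ and a divisor $d$ of $e$ with $e=d\cdot m$, a $d$-graceful labeling of $\Gamma$ is an injective function $f:V(\Gamma)\to\{0,1,\ldots,d(m+1)-1\}$ such that $\{|f(x)-f(y)| : [x,y]\in E(\Gamma)\}=\{1,2,\ldots,d(m+1)-1\}\setminus\{m+1,2(m+1),\ldots,(d-1)(m+1)\}$. $K_{a\times b}$ denotes the complete $a$-partite graph with $a$ parts each of size $b$. For a graph $K$ containing $\Gamma$ as a subgraph, a $\Gamma$-decomposition of $K$ is a set of subgraphs of $K$ (blocks) each isomorphic to $\Gamma$ whose edge sets partition $E(K)$. An automorphism of such a decomposition is a bijection of $V(K)$ leaving the set of blocks invariant; the decomposition is cyclic if it admits an automorphism that is a single cycle of length $|V(K)|$. -}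

module Defs where

open import Data.Nat using (ℕ; zero; suc; _+_; _*_; _∸_; _≤_; _<_; ∣_-_∣)
open import Data.Fin using (Fin; toℕ)
open import Data.Fin.Permutation using (Permutation′; _⟨$⟩ʳ_)
open import Data.List using (List; length)
open import Data.List.Membership.Propositional using (_∈_)
open import Data.List.Relation.Unary.All using (All)
open import Data.List.Relation.Unary.AllPairs using (AllPairs)
open import Data.Product using (Σ; ∃; ∃-syntax; _×_; _,_; proj₁; proj₂)
open import Data.Sum using (_⊎_)
open import Relation.Nullary using (¬_)
open import Relation.Binary.PropositionalEquality using (_≡_; _≢_)
open import Function.Bundles using (_⇔_)
open import Function.Definitions using (Injective)

-- Finite simple graphs, given by a vertex set Fin n and a list of
-- edges; each edge is an unordered pair {x,y} (stored as an ordered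
-- pair), no loops, and no edge is listed twice (in either orientation).

SameEdge : ∀ {A : Set} → A × A → A × A → Set
SameEdge (x , y) (u , v) = (x ≡ u × y ≡ v) ⊎ (x ≡ v × y ≡ u)

record Graph : Set where
  field
    n        : ℕ
    edges    : List (Fin n × Fin n)
    loopless : All (λ p → proj₁ p ≢ proj₂ p) edges
    distinct : AllPairs (λ p q → ¬ SameEdge p q) edges

open Graph public

size : Graph → ℕ
size Γ = length (edges Γ)

-- d-graceful labeling (with e = d * m)

InTargetSet : (d m k : ℕ) → Set
InTargetSet d m k =
  (1 ≤ k × k ≤ d * (m + 1) ∸ 1) ×
  ¬ (∃[ j ] (1 ≤ j × j ≤ d ∸ 1 × k ≡ j * (m + 1)))

record GracefulLabeling (d m : ℕ) (Γ : Graph) : Set where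
  field
    f         : Fin (n Γ) → ℕ
    injective : Injective _≡_ _≡_ f
    bounded   : ∀ x → f x < d * (m + 1)
    diffs     : ∀ k →
      (∃[ p ] (p ∈ edges Γ × ∣ f (proj₁ p) - f (proj₂ p) ∣ ≡ k))
        ⇔ InTargetSet d m k

-- Complete multipartite graph K_{a×b}: vertices Fin (a*b), vertex i
-- lies in part q iff q*b ≤ i < (q+1)*b; adjacency = different parts.

InPart : (b q : ℕ) → ℕ → Set
InPart b q i = q * b ≤ i × i < (q + 1) * b

SamePart : (a b : ℕ) → Fin (a * b) → Fin (a * b) → Set
SamePart a b u v = ∃[ q ] (q < a × InPart b q (toℕ u) × InPart b q (toℕ v))

record HostGraph : Set₁ where
  field
    N   : ℕ
    Adj : Fin N → Fin N → Set

Kmulti : (a b : ℕ) → HostGraph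
Kmulti a b = record { N = a * b ; Adj = λ u v → ¬ SamePart a b u v }

-- A block (a subgraph of K isomorphic to Γ) is given
-- as the image of an embedding φ : V(Γ) → V(K) (injective, edges go to
-- edges of K); the block is the subgraph with vertex set φ(V(Γ)) and
-- edge set {φ(x)φ(y) : [x,y] ∈ E(Γ)}.

module _ (Γ : Graph) (K : HostGraph) where
  open HostGraph K

  record Embedding : Set where
    field
      φ        : Fin (n Γ) → Fin N
      inj      : Injective _≡_ _≡_ φ
      edgesOK  : ∀ {p} → p ∈ edges Γ → Adj (φ (proj₁ p)) (φ (proj₂ p))

  open Embedding public

  BlockEdge : (Fin (n Γ) → Fin N) → Fin N → Fin N → Set
  BlockEdge φ u v =
    ∃[ p ] (p ∈ edges Γ × SameEdge (φ (proj₁ p) , φ (proj₂ p)) (u , v))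

  BlockVertex : (Fin (n Γ) → Fin N) → Fin N → Set
  BlockVertex φ u = ∃[ x ] (φ x ≡ u)

  SameBlock : (Fin (n Γ) → Fin N) → (Fin (n Γ) → Fin N) → Set
  SameBlock φ ψ =
    (∀ u → BlockVertex φ u ⇔ BlockVertex ψ u) ×
    (∀ u v → BlockEdge φ u v ⇔ BlockEdge ψ u v)

  record Decomposition : Set where
    field
      t         : ℕ
      block     : Fin t → Embedding
      partition : ∀ u v → Adj u v →
        ∃[ i ] (BlockEdge (φ (block i)) u v ×
                (∀ j → BlockEdge (φ (block j)) u v → j ≡ i))
      -- every edge of a block is an edge of K (implied by edgesOK) and
      -- the blocks are pairwise distinct
      distinctBlocks : ∀ i j → SameBlock (φ (block i)) (φ (block j)) → i ≡ j

  open Decomposition public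

  IsAutomorphism : Decomposition → Permutation′ N → Set
  IsAutomorphism D σ =
    (∀ i → ∃[ j ] SameBlock (λ x → σ ⟨$⟩ʳ φ (block D i) x) (φ (block D j))) ×
    (∀ j → ∃[ i ] SameBlock (λ x → σ ⟨$⟩ʳ φ (block D i) x) (φ (block D j)))

iter : ∀ {A : Set} → (A → A) → ℕ → A → A
iter g zero    x = x
iter g (suc k) x = g (iter g k x)

IsFullCycle : ∀ {N} → Permutation′ N → Set
IsFullCycle {N} σ = ∀ u v → ∃[ k ] (iter (σ ⟨$⟩ʳ_) k u ≡ v)

CyclicDecomposition : Graph → HostGraph → Set
CyclicDecomposition Γ K =
  Σ (Decomposition Γ K) λ D →
    ∃[ σ ] (IsFullCycle σ × IsAutomorphism Γ K D σ)

module Submission where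

-- Put c = m + 1, b = 2 * d and N = c * b = 2 * d * c.  The vertices of K get
-- coordinates in ℤ_N (CyclicModel) such that the parts of K are the residue
-- classes modulo c and adding 1 to the coordinate is a single N-cycle σ.  The
-- blocks are the N translates of f: the block at w puts vertex x of Γ at w + f x.
-- The labels lie below D = N / 2, and the edge distances |f x - f y| are
-- exactly the d * m non-multiples of c below D (TargetSet); since Γ has d * m
-- edges, each distance occurs on exactly one edge (Ranking, onto⇒injectiveOn).
-- As every non-multiple of c in ℤ_N is ± such a distance, each edge of K lies
-- in exactly one translate, and σ maps translates to translates.

open import Defs
open import Data.Nat using (ℕ; _*_; _+_; _<_)
open import Relation.Binary.PropositionalEquality using (_≡_)
open import Data.Nat
open import Data.Nat.Properties
open import Algebra.Properties.CommutativeSemigroup +-commutativeSemigroup using (interchange)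
open import Data.Nat.DivMod
open import Data.Nat.Divisibility using (divides-refl; m∣m*n)
open import Data.Nat.Tactic.RingSolver using (solve-∀)
open import Data.Empty using (⊥; ⊥-elim)
open import Data.Fin using (Fin; toℕ; fromℕ<; punchOut)
import Data.Fin.Properties as FP
open import Data.Fin.Permutation using (Permutation′; _⟨$⟩ʳ_; _⟨$⟩ˡ_; inverseʳ; permutation)
open import Data.List using (List; length; lookup)
open import Data.List.Membership.Propositional using (_∈_)
open import Data.List.Membership.Propositional.Properties using (∈-lookup)
import Data.List.Relation.Unary.All as All
import Data.List.Relation.Unary.Any as Any
open import Data.List.Relation.Unary.Any.Properties using (lookup-index)
open import Data.Product using (_×_; _,_; proj₁; proj₂; ∃-syntax; uncurry; map₂)
open import Data.Sum using (_⊎_; inj₁; inj₂)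
open import Function.Base using (_∘_)
open import Function.Bundles using (_⇔_; mk⇔; Equivalence)
open import Function.Definitions using (Injective)
open import Relation.Binary.Definitions using (tri<; tri≈; tri>)
open import Relation.Binary.PropositionalEquality
open import Relation.Nullary using (¬_; yes; no; contradiction)

divMod-unique : ∀ {z q r} c .{{_ : NonZero c}} → z ≡ q * c + r → r < c →
                z / c ≡ q × z % c ≡ r
divMod-unique {q = q} {r} c refl r<c =
  (begin
    (q * c + r) / c      ≡⟨ +-distrib-/-∣ˡ r (divides-refl q) ⟩
    q * c / c + r / c    ≡⟨ cong₂ _+_ (m*n/n≡m q c) (m<n⇒m/n≡0 r<c) ⟩
    q + 0                ≡⟨ +-identityʳ q ⟩
    q                    ∎) ,
  trans (%-remove-+ˡ r (divides-refl q)) (m<n⇒m%n≡m r<c)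
  where open ≡-Reasoning

infix 4 _≡_[mod_]
_≡_[mod_] : ℕ → ℕ → (n : ℕ) → .{{NonZero n}} → Set
a ≡ b [mod n ] = a % n ≡ b % n

module _ {n : ℕ} .{{_ : NonZero n}} where

  +-congʳ-mod : ∀ {a b} i → a ≡ b [mod n ] → a + i ≡ b + i [mod n ]
  +-congʳ-mod {a} {b} i a≡b = begin
    (a + i) % n              ≡⟨ %-distribˡ-+ a i n ⟩
    (a % n + i % n) % n      ≡⟨ cong (λ t → (t + i % n) % n) a≡b ⟩
    (b % n + i % n) % n      ≡⟨ %-distribˡ-+ b i n ⟨
    (b + i) % n              ∎
    where open ≡-Reasoning

  -- ... and can be cancelled: add i * (n - 1) more to reach a multiple of n
  +-cancelʳ-mod : ∀ {a b} i → a + i ≡ b + i [mod n ] → a ≡ b [mod n ]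
  +-cancelʳ-mod {a} {b} i a+i≡b+i = begin
    a % n                        ≡⟨ [m+kn]%n≡m%n a i n ⟨
    (a + i * n) % n              ≡⟨ cong (_% n) (complete a) ⟩
    (a + i + i * pred n) % n     ≡⟨ +-congʳ-mod (i * pred n) a+i≡b+i ⟩
    (b + i + i * pred n) % n     ≡⟨ cong (_% n) (complete b) ⟨
    (b + i * n) % n              ≡⟨ [m+kn]%n≡m%n b i n ⟩
    b % n                        ∎
    where
    open ≡-Reasoning
    complete : ∀ x → x + i * n ≡ x + i + i * pred n
    complete x = begin
      x + i * n                  ≡⟨ cong (λ k → x + i * k) (suc-pred n) ⟨
      x + i * suc (pred n)       ≡⟨ cong (x +_) (*-suc i (pred n)) ⟩
      x + (i + i * pred n)       ≡⟨ +-assoc x i _ ⟨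
      x + i + i * pred n         ∎

  +-cancelˡ-mod : ∀ {a b} i → i + a ≡ i + b [mod n ] → a ≡ b [mod n ]
  +-cancelˡ-mod {a} {b} i i+a≡i+b =
    +-cancelʳ-mod i (subst₂ (λ x y → x ≡ y [mod n ]) (+-comm i a) (+-comm i b) i+a≡i+b)

  +-congˡ-mod : ∀ {a b} i → a ≡ b [mod n ] → i + a ≡ i + b [mod n ]
  +-congˡ-mod {a} {b} i a≡b =
    subst₂ (λ x y → x ≡ y [mod n ]) (+-comm a i) (+-comm b i) (+-congʳ-mod i a≡b)

  +-cong-mod : ∀ {a b a′ b′} → a ≡ a′ [mod n ] → b ≡ b′ [mod n ] → a + b ≡ a′ + b′ [mod n ]
  +-cong-mod {a} {b} {a′} {b′} a≡a′ b≡b′ = begin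
    (a + b) % n              ≡⟨ %-distribˡ-+ a b n ⟩
    (a % n + b % n) % n      ≡⟨ cong₂ (λ x y → (x + y) % n) a≡a′ b≡b′ ⟩
    (a′ % n + b′ % n) % n    ≡⟨ %-distribˡ-+ a′ b′ n ⟨
    (a′ + b′) % n            ∎
    where open ≡-Reasoning

  translate-crossSum : ∀ {i j a b a′ b′} → i + a ≡ j + a′ [mod n ] → i + b ≡ j + b′ [mod n ] →
                       a + b′ ≡ a′ + b [mod n ]
  translate-crossSum {i} {j} {a} {b} {a′} {b′} ia≡ja′ ib≡jb′ =
    +-cancelˡ-mod (i + j) (subst₂ (λ x y → x ≡ y [mod n ])
      (interchange i a j b′) (trans (+-comm (j + a′) (i + b))
        (trans (interchange i b j a′) (cong (i + j +_) (+-comm b a′))))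
      (+-cong-mod {i + a} {j + b′} ia≡ja′ (sym ib≡jb′)))

  mod-small : ∀ {a b} → a < n → b < n → a ≡ b [mod n ] → a ≡ b
  mod-small a<n b<n a≡b = trans (sym (m<n⇒m%n≡m a<n)) (trans a≡b (m<n⇒m%n≡m b<n))

  %-absorbˡ : ∀ a i → a % n + i ≡ a + i [mod n ]
  %-absorbˡ a i = +-congʳ-mod i (m%n%n≡m%n a n)

  ∸-mod : ∀ {a b} → a ≤ b → b ≡ a [mod n ] → (b ∸ a) % n ≡ 0
  ∸-mod {a} {b} a≤b b≡a = trans
    (+-cancelʳ-mod a (subst (λ z → z ≡ a [mod n ]) (sym (m∸n+n≡m a≤b)) b≡a))
    (m<n⇒m%n≡m (>-nonZero⁻¹ n))

  ∣-∣-mod : ∀ {a b} → a ≡ b [mod n ] → ∣ a - b ∣ % n ≡ 0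
  ∣-∣-mod {a} {b} a≡b with ≤-total a b
  ... | inj₁ a≤b = trans (cong (_% n) (m≤n⇒∣m-n∣≡n∸m a≤b)) (∸-mod a≤b (sym a≡b))
  ... | inj₂ b≤a = trans (cong (_% n) (m≤n⇒∣n-m∣≡n∸m b≤a)) (∸-mod b≤a a≡b)

-- Transposition of a c × b grid: z = q * c + r (r < c) is sent to r * b + q.
-- It maps [0, c * b) to itself, sending residues modulo c to quotients by b.
transpose : (c b : ℕ) .{{_ : NonZero c}} → ℕ → ℕ
transpose c b z = (z % c) * b + z / c

module _ (c b : ℕ) .{{_ : NonZero c}} .{{_ : NonZero b}} {z : ℕ} (z<cb : z < c * b) where

  private
    quotient< : z / c < b
    quotient< = m<n*o⇒m/o<n (subst (z <_) (*-comm c b) z<cb)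

  transpose-divMod : transpose c b z / b ≡ z % c × transpose c b z % b ≡ z / c
  transpose-divMod = divMod-unique b refl quotient<

  transpose-< : transpose c b z < c * b
  transpose-< = begin-strict
    (z % c) * b + z / c    <⟨ +-monoʳ-< ((z % c) * b) quotient< ⟩
    (z % c) * b + b        ≡⟨ +-comm ((z % c) * b) b ⟩
    suc (z % c) * b        ≤⟨ *-monoˡ-≤ b (m%n<n z c) ⟩
    c * b                  ∎
    where open ≤-Reasoning

  transpose-involutive : transpose b c (transpose c b z) ≡ z
  transpose-involutive = begin
    (w % b) * c + w / b    ≡⟨ cong₂ (λ x y → x * c + y) (proj₂ transpose-divMod) (proj₁ transpose-divMod) ⟩
    (z / c) * c + z % c    ≡⟨ +-comm ((z / c) * c) (z % c) ⟩
    z % c + (z / c) * c    ≡⟨ m≡m%n+[m/n]*n z c ⟨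
    z                      ∎
    where
    open ≡-Reasoning
    w : ℕ
    w = transpose c b z

module _ {b : ℕ} .{{_ : NonZero b}} where

  inPart-/ : ∀ w → InPart b (w / b) w
  inPart-/ w = m/n*n≤m w b , (begin-strict
    w                      ≡⟨ m≡m%n+[m/n]*n w b ⟩
    w % b + (w / b) * b    <⟨ +-monoˡ-< ((w / b) * b) (m%n<n w b) ⟩
    b + (w / b) * b        ≡⟨ cong (_* b) (+-comm 1 (w / b)) ⟩
    (w / b + 1) * b        ∎)
    where open ≤-Reasoning

  inPart⇒/ : ∀ {q w} → InPart b q w → w / b ≡ q
  inPart⇒/ {q} {w} (q*b≤w , w<[q+1]*b) =
    proj₁ (divMod-unique b (sym (m+[n∸m]≡n q*b≤w)) (m<n+o⇒m∸n<o w (q * b) w<q*b+b))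
    where
    w<q*b+b : w < q * b + b
    w<q*b+b = subst (w <_) (trans (cong (_* b) (+-comm q 1)) (+-comm b (q * b))) w<[q+1]*b

  samePart⇔ : ∀ {a} (u v : Fin (a * b)) → SamePart a b u v ⇔ toℕ u / b ≡ toℕ v / b
  samePart⇔ {a} u v = mk⇔
    (λ (q , _ , u∈q , v∈q) → trans (inPart⇒/ {q} u∈q) (sym (inPart⇒/ {q} v∈q)))
    (λ same → toℕ u / b , m<n*o⇒m/o<n (FP.toℕ<n u) , inPart-/ (toℕ u) ,
              subst (λ q → InPart b q (toℕ v)) (sym same) (inPart-/ (toℕ v)))

samePart-sym : ∀ {a b} {u v : Fin (a * b)} → SamePart a b u v → SamePart a b v u
samePart-sym (q , q<a , u∈q , v∈q) = q , q<a , v∈q , u∈q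

onePart : ∀ b (u v : Fin (1 * b)) → SamePart 1 b u v
onePart b u v = 0 , s≤s z≤n , (z≤n , FP.toℕ<n u) , (z≤n , FP.toℕ<n v)

-- A self-map of Fin n with a right inverse is injective: if F i ≡ F j with
-- i ≢ j, then every value is attained away from j, giving an injection
-- Fin n → Fin (n - 1).
rightInverse⇒injective : ∀ {n} (F G : Fin n → Fin n) → (∀ y → F (G y) ≡ y) →
                         Injective _≡_ _≡_ F
rightInverse⇒injective {suc n} F G FG {i} {j} Fi≡Fj with i FP.≟ j
... | yes i≡j = i≡j
... | no i≢j = contradiction (FP.injective⇒≤ squeeze-injective) 1+n≰n
  where
  avoiding : ∀ y → ∃[ z ] (j ≢ z × F z ≡ y)
  avoiding y with G y FP.≟ j
  ... | yes Gy≡j = i , i≢j ∘ sym , trans Fi≡Fj (trans (cong F (sym Gy≡j)) (FG y))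
  ... | no Gy≢j  = G y , Gy≢j ∘ sym , FG y

  preimage : Fin (suc n) → Fin (suc n)
  preimage y = proj₁ (avoiding y)

  j≢preimage : ∀ y → j ≢ preimage y
  j≢preimage y = proj₁ (proj₂ (avoiding y))

  squeeze : Fin (suc n) → Fin n
  squeeze y = punchOut (j≢preimage y)

  squeeze-injective : Injective _≡_ _≡_ squeeze
  squeeze-injective {x} {y} eq = begin
    x                  ≡⟨ proj₂ (proj₂ (avoiding x)) ⟨
    F (preimage x)     ≡⟨ cong F (FP.punchOut-injective (j≢preimage x) (j≢preimage y) eq) ⟩
    F (preimage y)     ≡⟨ proj₂ (proj₂ (avoiding y)) ⟩
    y                  ∎
    where open ≡-Reasoning

onto⇒injectiveOn : ∀ {A : Set} (xs : List A) (h : A → ℕ) →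
  (∀ {x} → x ∈ xs → h x < length xs) →
  (∀ y → y < length xs → ∃[ x ] (x ∈ xs × h x ≡ y)) →
  ∀ {x x′} → x ∈ xs → x′ ∈ xs → h x ≡ h x′ → x ≡ x′
onto⇒injectiveOn xs h bounded onto {x} {x′} x∈ x′∈ hx≡hx′ = begin
  x                          ≡⟨ lookup-index x∈ ⟩
  lookup xs (Any.index x∈)   ≡⟨ cong (lookup xs) (F-injective (FP.toℕ-injective (begin
      toℕ (F (Any.index x∈))    ≡⟨ toℕ-F (Any.index x∈) ⟩
      h (lookup xs _)           ≡⟨ cong h (lookup-index x∈) ⟨
      h x                       ≡⟨ hx≡hx′ ⟩
      h x′                      ≡⟨ cong h (lookup-index x′∈) ⟩
      h (lookup xs _)           ≡⟨ toℕ-F (Any.index x′∈) ⟨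
      toℕ (F (Any.index x′∈))   ∎))) ⟩
  lookup xs (Any.index x′∈)  ≡⟨ lookup-index x′∈ ⟨
  x′                         ∎
  where
  open ≡-Reasoning
  F : Fin (length xs) → Fin (length xs)
  F i = fromℕ< (bounded (∈-lookup i))

  toℕ-F : ∀ i → toℕ (F i) ≡ h (lookup xs i)
  toℕ-F i = FP.toℕ-fromℕ< _

  G : Fin (length xs) → Fin (length xs)
  G y = Any.index (proj₁ (proj₂ (onto (toℕ y) (FP.toℕ<n y))))

  FG : ∀ y → F (G y) ≡ y
  FG y = FP.toℕ-injective (begin
    toℕ (F (G y))              ≡⟨ toℕ-F (G y) ⟩
    h (lookup xs (G y))        ≡⟨ cong h (lookup-index x∈xs) ⟨
    h w                        ≡⟨ hw≡y ⟩
    toℕ y                      ∎)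
    where
    witness : ∃[ x ] (x ∈ xs × h x ≡ toℕ y)
    witness = onto (toℕ y) (FP.toℕ<n y)
    w = proj₁ witness
    x∈xs = proj₁ (proj₂ witness)
    hw≡y = proj₂ (proj₂ witness)

  F-injective : Injective _≡_ _≡_ F
  F-injective = rightInverse⇒injective F G FG

-- Vertex w of K_{c×b} (part w / b) is given
-- the coordinate transpose b c w ∈ ℤ_N, N = c * b; under this labelling the
-- parts are exactly the residue classes modulo c, and adding 1 to the
-- coordinate is a single N-cycle on the vertices.
module CyclicModel (c b : ℕ) .{{_ : NonZero c}} .{{_ : NonZero b}} where

  N : ℕ
  N = c * b

  instance
    N≢0 : NonZero N
    N≢0 = m*n≢0 c b

  vertex : ℕ → Fin N
  vertex s = fromℕ< (transpose-< c b (m%n<n s N))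

  coord : Fin N → ℕ
  coord u = transpose b c (toℕ u)

  private
    toℕ<bc : ∀ (u : Fin N) → toℕ u < b * c
    toℕ<bc u = subst (toℕ u <_) (*-comm c b) (FP.toℕ<n u)

    toℕ-vertex : ∀ s → toℕ (vertex s) ≡ transpose c b (s % N)
    toℕ-vertex s = FP.toℕ-fromℕ< _

  coord< : ∀ u → coord u < N
  coord< u = subst (coord u <_) (*-comm b c) (transpose-< b c (toℕ<bc u))

  vertex-coord : ∀ u → vertex (coord u) ≡ u
  vertex-coord u = FP.toℕ-injective (begin
    toℕ (vertex (coord u))        ≡⟨ toℕ-vertex (coord u) ⟩
    transpose c b (coord u % N)   ≡⟨ cong (transpose c b) (m<n⇒m%n≡m (coord< u)) ⟩
    transpose c b (coord u)       ≡⟨ transpose-involutive b c (toℕ<bc u) ⟩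
    toℕ u                         ∎)
    where open ≡-Reasoning

  coord-vertex : ∀ s → coord (vertex s) ≡ s % N
  coord-vertex s = trans (cong (transpose b c) (toℕ-vertex s))
                         (transpose-involutive c b (m%n<n s N))

  vertex-cong : ∀ {s t} → s ≡ t [mod N ] → vertex s ≡ vertex t
  vertex-cong s≡t = FP.toℕ-injective
    (trans (toℕ-vertex _) (trans (cong (transpose c b) s≡t) (sym (toℕ-vertex _))))

  vertex-injective : ∀ {s t} → vertex s ≡ vertex t → s ≡ t [mod N ]
  vertex-injective {s} {t} eq =
    trans (sym (coord-vertex s)) (trans (cong coord eq) (coord-vertex t))

  vertex-≡ : ∀ {s u} → s ≡ coord u [mod N ] → vertex s ≡ u
  vertex-≡ {u = u} s≡u = trans (vertex-cong s≡u) (vertex-coord u)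

  samePart-vertex : ∀ s t → SamePart c b (vertex s) (vertex t) ⇔ s ≡ t [mod c ]
  samePart-vertex s t = mk⇔
    (λ same → trans (sym (part s)) (trans (Equivalence.to (samePart⇔ (vertex s) (vertex t)) same) (part t)))
    (λ s≡t → Equivalence.from (samePart⇔ (vertex s) (vertex t)) (trans (part s) (trans s≡t (sym (part t)))))
    where
    part : ∀ s → toℕ (vertex s) / b ≡ s % c
    part s = begin
      toℕ (vertex s) / b               ≡⟨ cong (_/ b) (toℕ-vertex s) ⟩
      transpose c b (s % N) / b        ≡⟨ proj₁ (transpose-divMod c b (m%n<n s N)) ⟩
      s % N % c                        ≡⟨ m∣n⇒o%n%m≡o%m c N s (m∣m*n b) ⟩
      s % c                            ∎
      where open ≡-Reasoning

  rotate : ℕ → Fin N → Fin N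
  rotate k u = vertex (coord u + k)

  rotate-≡ : ∀ {k u v} → coord u + k ≡ coord v [mod N ] → rotate k u ≡ v
  rotate-≡ = vertex-≡

  rotate-zero : ∀ u → rotate 0 u ≡ u
  rotate-zero u = rotate-≡ (cong (_% N) (+-identityʳ (coord u)))

  rotate-rotate : ∀ j k u → rotate j (rotate k u) ≡ rotate (k + j) u
  rotate-rotate j k u = vertex-cong (begin
    (coord (vertex (coord u + k)) + j) % N    ≡⟨ cong (λ x → (x + j) % N) (coord-vertex (coord u + k)) ⟩
    ((coord u + k) % N + j) % N               ≡⟨ %-absorbˡ {N} (coord u + k) j ⟩
    (coord u + k + j) % N                     ≡⟨ cong (_% N) (+-assoc (coord u) k j) ⟩
    (coord u + (k + j)) % N                   ∎)
    where open ≡-Reasoning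

  rotate-comm : ∀ j k u → rotate j (rotate k u) ≡ rotate k (rotate j u)
  rotate-comm j k u = trans (rotate-rotate j k u)
    (trans (cong (λ x → rotate x u) (+-comm k j)) (sym (rotate-rotate k j u)))

  rotate-cancel : ∀ {j k} → k + j ≡ N → ∀ u → rotate j (rotate k u) ≡ u
  rotate-cancel {j} {k} k+j≡N u = trans (rotate-rotate j k u)
    (rotate-≡ (trans (cong (λ x → (coord u + x) % N) k+j≡N) ([m+n]%n≡m%n (coord u) N)))

  rotate-mod : ∀ k u → rotate (k % N) u ≡ rotate k u
  rotate-mod k u = vertex-cong (+-cong-mod {N} {coord u} refl (m%n%n≡m%n k N))

  coord-injective : ∀ {u v} → coord u ≡ coord v [mod N ] → u ≡ v
  coord-injective {u} u≡v = trans (sym (vertex-coord u)) (vertex-≡ u≡v)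

  rotate-reach : ∀ u v → ∃[ k ] (k < N × rotate k u ≡ v)
  rotate-reach u v = k % N , m%n<n k N ,
    trans (rotate-mod k u) (rotate-≡ (trans (cong (_% N) coord-u+k≡coord-v+N) ([m+n]%n≡m%n (coord v) N)))
    where
    k : ℕ
    k = coord v + (N ∸ coord u)

    coord-u+k≡coord-v+N : coord u + k ≡ coord v + N
    coord-u+k≡coord-v+N = begin
      coord u + (coord v + (N ∸ coord u))    ≡⟨ +-assoc (coord u) (coord v) _ ⟨
      coord u + coord v + (N ∸ coord u)      ≡⟨ cong (_+ (N ∸ coord u)) (+-comm (coord u) (coord v)) ⟩
      coord v + coord u + (N ∸ coord u)      ≡⟨ +-assoc (coord v) (coord u) _ ⟩
      coord v + (coord u + (N ∸ coord u))    ≡⟨ cong (coord v +_) (m+[n∸m]≡n (<⇒≤ (coord< u))) ⟩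
      coord v + N                            ∎
      where open ≡-Reasoning

  rotate-samePart⇔ : ∀ j k u → SamePart c b (rotate j u) (rotate k u) ⇔ j ≡ k [mod c ]
  rotate-samePart⇔ j k u = mk⇔
    (λ same → +-cancelˡ-mod (coord u) (Equivalence.to (samePart-vertex _ _) same))
    (λ j≡k → Equivalence.from (samePart-vertex _ _) (+-congˡ-mod (coord u) j≡k))

  σ : Permutation′ N
  σ = permutation (rotate 1) (rotate (N ∸ 1))
        (rotate-cancel (m∸n+n≡m {N} {1} (>-nonZero⁻¹ N)))
        (rotate-cancel (m+[n∸m]≡n {1} {N} (>-nonZero⁻¹ N)))

  iterate-σ : ∀ k u → iter (σ ⟨$⟩ʳ_) k u ≡ rotate k u
  iterate-σ zero    u = sym (rotate-zero u)
  iterate-σ (suc k) u = trans (cong (rotate 1) (iterate-σ k u))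
                              (trans (rotate-rotate 1 k u) (cong (λ x → rotate x u) (+-comm k 1)))

  σ-fullCycle : IsFullCycle σ
  σ-fullCycle u v = let (k , _ , rotate-k-u≡v) = rotate-reach u v in k , trans (iterate-σ k u) rotate-k-u≡v

≤∸1⇒< : ∀ {k x} → 0 < k → k ≤ x ∸ 1 → k < x
≤∸1⇒< {x = zero}  (s≤s z≤n) ()
≤∸1⇒< {x = suc x} _         k≤x = s≤s k≤x

<⇒≤∸1 : ∀ {k x} → k < x → k ≤ x ∸ 1
<⇒≤∸1 (s≤s k≤x) = k≤x

module TargetSet (d m : ℕ) where

  c : ℕ
  c = m + 1

  instance
    c≢0 : NonZero c
    c≢0 = >-nonZero (m≤n+m 1 m)

  0%c≡0 : 0 % c ≡ 0
  0%c≡0 = m<n⇒m%n≡m (>-nonZero⁻¹ c)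

  inTarget⇔ : ∀ k → InTargetSet d m k ⇔ (k < d * c × k % c ≢ 0)
  inTarget⇔ k = mk⇔
    (λ ((0<k , k≤dc∸1) , notMultiple) → ≤∸1⇒< 0<k k≤dc∸1 , λ k%c≡0 →
       notMultiple (multiplier 0<k (≤∸1⇒< 0<k k≤dc∸1) k%c≡0))
    (λ (k<dc , k%c≢0) → (positive k%c≢0 , <⇒≤∸1 k<dc) ,
       λ (j , _ , _ , k≡jc) → k%c≢0 (trans (cong (_% c) k≡jc) (m*n%n≡0 j c)))
    where
    positive : ∀ {k} → k % c ≢ 0 → 0 < k
    positive {zero}  0%c≢0 = contradiction 0%c≡0 0%c≢0
    positive {suc k} _     = s≤s z≤n

    multiplier : ∀ {k} → 0 < k → k < d * c → k % c ≡ 0 →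
                 ∃[ j ] (1 ≤ j × j ≤ d ∸ 1 × k ≡ j * (m + 1))
    multiplier {k} 0<k k<dc k%c≡0 = k / c , 1≤k/c , <⇒≤∸1 k/c<d , k≡k/c*c
      where
      k≡k/c*c : k ≡ k / c * c
      k≡k/c*c = trans (m≡m%n+[m/n]*n k c) (cong (_+ k / c * c) k%c≡0)
      1≤k/c : 1 ≤ k / c
      1≤k/c = n≢0⇒n>0 (λ k/c≡0 → <⇒≢ 0<k (sym (trans k≡k/c*c (cong (_* c) k/c≡0))))
      k/c<d : k / c < d
      k/c<d = *-cancelʳ-< c (k / c) d (subst (_< d * c) k≡k/c*c k<dc)

  -- Ranking the non-multiples of c below d * c: in increasing order the y-th
  -- one (counting from 0) is unrank y, and rank recovers y.  Hence the target
  -- set has exactly d * m elements.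
  module Ranking .{{_ : NonZero m}} where

    rank : ℕ → ℕ
    rank k = (k / c) * m + (k % c ∸ 1)

    unrank : ℕ → ℕ
    unrank y = (y / m) * c + suc (y % m)

    private
      suc<c : ∀ {x} → x < m → suc x < c
      suc<c {x} x<m = subst (suc x <_) (+-comm 1 m) (s≤s x<m)

      unrank-divMod : ∀ y → unrank y / c ≡ y / m × unrank y % c ≡ suc (y % m)
      unrank-divMod y = divMod-unique c refl (suc<c (m%n<n y m))

    rank< : ∀ {k} → k < d * c → k % c ≢ 0 → rank k < d * m
    rank< {k} k<dc k%c≢0 = begin-strict
      (k / c) * m + (k % c ∸ 1)    <⟨ +-monoʳ-< ((k / c) * m) (remainder< (k % c) k%c≢0 (m%n<n k c)) ⟩
      (k / c) * m + m              ≡⟨ +-comm ((k / c) * m) m ⟩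
      suc (k / c) * m              ≤⟨ *-monoˡ-≤ m (m<n*o⇒m/o<n {n = d} k<dc) ⟩
      d * m                        ∎
      where
      open ≤-Reasoning
      remainder< : ∀ r → r ≢ 0 → r < c → r ∸ 1 < m
      remainder< zero    r≢0 _   = contradiction refl r≢0
      remainder< (suc r) _   r<c = ≤-pred (subst (suc r <_) (+-comm m 1) r<c)

    unrank-inTarget : ∀ {y} → y < d * m → unrank y < d * c × unrank y % c ≢ 0
    unrank-inTarget {y} y<dm = bound , λ eq → 1+n≢0 (trans (sym (proj₂ (unrank-divMod y))) eq)
      where
      open ≤-Reasoning
      bound : unrank y < d * c
      bound = begin-strict
        (y / m) * c + suc (y % m)   <⟨ +-monoʳ-< ((y / m) * c) (suc<c (m%n<n y m)) ⟩
        (y / m) * c + c             ≡⟨ +-comm ((y / m) * c) c ⟩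
        suc (y / m) * c             ≤⟨ *-monoˡ-≤ c (m<n*o⇒m/o<n {n = d} y<dm) ⟩
        d * c                       ∎

    rank-unrank : ∀ y → rank (unrank y) ≡ y
    rank-unrank y = begin
      (unrank y / c) * m + (unrank y % c ∸ 1)  ≡⟨ cong₂ (λ q r → q * m + (r ∸ 1)) (proj₁ (unrank-divMod y)) (proj₂ (unrank-divMod y)) ⟩
      (y / m) * m + y % m                      ≡⟨ +-comm ((y / m) * m) (y % m) ⟩
      y % m + (y / m) * m                      ≡⟨ m≡m%n+[m/n]*n y m ⟨
      y                                        ∎
      where open ≡-Reasoning

∣-∣-orient : ∀ x y → y ≡ x + ∣ x - y ∣ ⊎ x ≡ y + ∣ x - y ∣
∣-∣-orient x y with ≤-total x y
... | inj₁ x≤y = inj₁ (trans (sym (m+[n∸m]≡n x≤y)) (cong (x +_) (sym (m≤n⇒∣m-n∣≡n∸m x≤y))))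
... | inj₂ y≤x = inj₂ (trans (sym (m+[n∸m]≡n y≤x)) (cong (y +_) (sym (m≤n⇒∣n-m∣≡n∸m y≤x))))

∣-∣-balanced : ∀ a b a′ b′ → a + b′ ≡ a′ + b → ∣ a - b ∣ ≡ ∣ a′ - b′ ∣
∣-∣-balanced a b a′ b′ a+b′≡a′+b = begin
  ∣ a - b ∣                 ≡⟨ ∣m+n-m+o∣≡∣n-o∣ b′ a b ⟨
  ∣ b′ + a - b′ + b ∣       ≡⟨ cong₂ ∣_-_∣ (trans (+-comm b′ a) (trans a+b′≡a′+b (+-comm a′ b))) (+-comm b′ b) ⟩
  ∣ b + a′ - b + b′ ∣       ≡⟨ ∣m+n-m+o∣≡∣n-o∣ b a′ b′ ⟩
  ∣ a′ - b′ ∣               ∎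
  where open ≡-Reasoning

double-injective : ∀ {a b} → a + a ≡ b + b → a ≡ b
double-injective {a} {b} a+a≡b+b = *-cancelˡ-≡ a b 2
  (trans (cong (a +_) (+-identityʳ a)) (trans a+a≡b+b (cong (b +_) (sym (+-identityʳ b)))))

sameEdge-join : ∀ {A : Set} {x y e : A × A} → SameEdge x e → SameEdge y e → SameEdge x y
sameEdge-join (inj₁ (x₁≡u , x₂≡v)) (inj₁ (y₁≡u , y₂≡v)) = inj₁ (trans x₁≡u (sym y₁≡u) , trans x₂≡v (sym y₂≡v))
sameEdge-join (inj₁ (x₁≡u , x₂≡v)) (inj₂ (y₁≡v , y₂≡u)) = inj₂ (trans x₁≡u (sym y₂≡u) , trans x₂≡v (sym y₁≡v))
sameEdge-join (inj₂ (x₁≡v , x₂≡u)) (inj₁ (y₁≡u , y₂≡v)) = inj₂ (trans x₁≡v (sym y₂≡v) , trans x₂≡u (sym y₁≡u))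
sameEdge-join (inj₂ (x₁≡v , x₂≡u)) (inj₂ (y₁≡v , y₂≡u)) = inj₁ (trans x₁≡v (sym y₁≡v) , trans x₂≡u (sym y₂≡u))

module _ {Γ : Graph} {K : HostGraph} where
  open HostGraph K

  blockEdge-swap : ∀ {φ u v} → BlockEdge Γ K φ u v → BlockEdge Γ K φ v u
  blockEdge-swap (p , p∈ , inj₁ (eu , ev)) = p , p∈ , inj₂ (eu , ev)
  blockEdge-swap (p , p∈ , inj₂ (ev , eu)) = p , p∈ , inj₁ (ev , eu)

  sameBlock-≗ : ∀ {φ ψ} → (∀ x → φ x ≡ ψ x) → SameBlock Γ K φ ψ
  sameBlock-≗ {φ} {ψ} φ≗ψ =
    (λ u → mk⇔ (λ (x , φx≡u) → x , trans (sym (φ≗ψ x)) φx≡u)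
               (λ (x , ψx≡u) → x , trans (φ≗ψ x) ψx≡u)) ,
    (λ u v → mk⇔ (λ (p , p∈ , e) → p , p∈ , subst (λ z → SameEdge z (u , v)) (image≡ p) e)
                 (λ (p , p∈ , e) → p , p∈ , subst (λ z → SameEdge z (u , v)) (sym (image≡ p)) e))
    where
    image≡ : ∀ (p : Fin (n Γ) × Fin (n Γ)) → (φ (proj₁ p) , φ (proj₂ p)) ≡ (ψ (proj₁ p) , ψ (proj₂ p))
    image≡ p = cong₂ _,_ (φ≗ψ (proj₁ p)) (φ≗ψ (proj₂ p))

  equivariant⇒automorphism : (D : Decomposition Γ K) (σ : Permutation′ N) (τ : Permutation′ (t D)) →
    (∀ i x → σ ⟨$⟩ʳ φ (block D i) x ≡ φ (block D (τ ⟨$⟩ʳ i)) x) → IsAutomorphism Γ K D σ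
  equivariant⇒automorphism D σ τ equivariant =
    (λ i → τ ⟨$⟩ʳ i , sameBlock-≗ (equivariant i)) ,
    (λ j → τ ⟨$⟩ˡ j , sameBlock-≗ (λ x → trans (equivariant (τ ⟨$⟩ˡ j) x) (cong (λ i → φ (block D i) x) (inverseʳ τ))))

  edgeless⇒cyclic : (∀ u v → ¬ Adj u v) → (σ : Permutation′ N) → IsFullCycle σ → CyclicDecomposition Γ K
  edgeless⇒cyclic noEdges σ cycle =
    record { t = 0 ; block = λ () ; partition = λ u v adj → ⊥-elim (noEdges u v adj) ; distinctBlocks = λ () } ,
    σ , cycle , (λ ()) , (λ ())

module Construction (Γ : Graph) (d m : ℕ) .{{_ : NonZero d}} .{{_ : NonZero m}}
                    (L : GracefulLabeling d m Γ) (size≡ : size Γ ≡ d * m) where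

  open TargetSet d m
  open Ranking
  open GracefulLabeling L

  b : ℕ
  b = 2 * d

  instance
    b≢0 : NonZero b
    b≢0 = m*n≢0 2 d

  open CyclicModel c b

  K : HostGraph
  K = Kmulti c b

  D : ℕ
  D = d * c

  D+D≡N : D + D ≡ N
  D+D≡N = twice d c
    where
    twice : ∀ x y → x * y + x * y ≡ y * (2 * x)
    twice = solve-∀

  label<N : ∀ x → f x < N
  label<N x = <-≤-trans (bounded x) (subst (D ≤_) D+D≡N (m≤m+n D D))

  labelSum<N : ∀ x y → f x + f y < N
  labelSum<N x y = subst (f x + f y <_) D+D≡N (+-mono-< (bounded x) (bounded y))

  E : List (Fin (n Γ) × Fin (n Γ))
  E = edges Γ

  δ : Fin (n Γ) × Fin (n Γ) → ℕ
  δ p = ∣ f (proj₁ p) - f (proj₂ p) ∣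

  δ-inTarget : ∀ {p} → p ∈ E → δ p < D × δ p % c ≢ 0
  δ-inTarget {p} p∈ = Equivalence.to (inTarget⇔ (δ p)) (Equivalence.to (diffs (δ p)) (p , p∈ , refl))

  edgeAt : ∀ {k} → k < D → k % c ≢ 0 → ∃[ p ] (p ∈ E × δ p ≡ k)
  edgeAt k<D k%c≢0 = Equivalence.from (diffs _) (Equivalence.from (inTarget⇔ _) (k<D , k%c≢0))

  -- ... and, as there are d * m of each, every distance occurs on exactly one edge
  δ-injective : ∀ {p q} → p ∈ E → q ∈ E → δ p ≡ δ q → p ≡ q
  δ-injective p∈ q∈ δp≡δq = onto⇒injectiveOn E (rank ∘ δ) bound onto p∈ q∈ (cong rank δp≡δq)
    where
    bound : ∀ {p} → p ∈ E → rank (δ p) < length E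
    bound {p} p∈ = subst (rank (δ p) <_) (sym size≡) (uncurry rank< (δ-inTarget p∈))

    onto : ∀ y → y < length E → ∃[ p ] (p ∈ E × rank (δ p) ≡ y)
    onto y y<E with p , p∈ , δp≡ ← uncurry edgeAt (unrank-inTarget (subst (y <_) size≡ y<E)) =
      p , p∈ , trans (cong rank δp≡) (rank-unrank y)

  place : Fin N → Fin (n Γ) → Fin N
  place w x = rotate (f x) w

  place-injective : ∀ w → Injective _≡_ _≡_ (place w)
  place-injective w {x} {y} eq =
    injective (mod-small (label<N x) (label<N y) (+-cancelˡ-mod {N} (coord w) (vertex-injective eq)))

  -- the ends of an edge of Γ are placed in different parts, since their labels
  -- differ by a non-multiple of c
  place-edge : ∀ w {p} → p ∈ E → ¬ SamePart c b (place w (proj₁ p)) (place w (proj₂ p))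
  place-edge w {p} p∈ same =
    proj₂ (δ-inTarget p∈) (∣-∣-mod {c} (Equivalence.to (rotate-samePart⇔ (f (proj₁ p)) (f (proj₂ p)) w) same))

  blockAt : Fin N → Embedding Γ K
  blockAt w = record { φ = place w ; inj = place-injective w ; edgesOK = place-edge w }

  -- If the translates by coord w and coord w′ of two labelled pairs coincide,
  -- their cross sums agree exactly, since all labels lie below N / 2.
  crossSum : ∀ w w′ {x y x′ y′} → place w x ≡ place w′ x′ → place w y ≡ place w′ y′ →
             f x + f y′ ≡ f x′ + f y
  crossSum w w′ {x} {y} {x′} {y′} wx≡w′x′ wy≡w′y′ =
    mod-small (labelSum<N x y′) (labelSum<N x′ y)
      (translate-crossSum {N} {coord w} {coord w′} {f x} {f y} {f x′} {f y′}
        (vertex-injective wx≡w′x′) (vertex-injective wy≡w′y′))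

  -- Edges of Γ placed onto the same pair of vertices by blocks w and w′ have the
  -- same distance, so they coincide by δ-injective.  Placed in the same
  -- orientation they force w ≡ w′; placed in opposite orientations they would
  -- force the two ends of the edge to carry equal labels.
  module _ {w w′ : Fin N} {p q : Fin (n Γ) × Fin (n Γ)} (p∈ : p ∈ E) (q∈ : q ∈ E) where
    private
      p₁ p₂ q₁ q₂ : Fin (n Γ)
      p₁ = proj₁ p
      p₂ = proj₂ p
      q₁ = proj₁ q
      q₂ = proj₂ q

    straightImage : place w p₁ ≡ place w′ q₁ → place w p₂ ≡ place w′ q₂ → w ≡ w′
    straightImage e₁ e₂ = coord-injective (+-cancelʳ-mod {N} {coord w} {coord w′} (f p₁)
      (vertex-injective (trans e₁ (cong (λ r → place w′ (proj₁ r)) (sym p≡q)))))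
      where
      p≡q : p ≡ q
      p≡q = δ-injective p∈ q∈ (∣-∣-balanced (f p₁) (f p₂) (f q₁) (f q₂) (crossSum w w′ e₁ e₂))

    crossedImage : place w p₁ ≡ place w′ q₂ → place w p₂ ≡ place w′ q₁ → ⊥
    crossedImage e₁ e₂ = All.lookup (loopless Γ) p∈
      (injective (double-injective (subst (λ r → f p₁ + f (proj₁ r) ≡ f (proj₂ r) + f p₂) (sym p≡q) sums)))
      where
      sums : f p₁ + f q₁ ≡ f q₂ + f p₂
      sums = crossSum w w′ e₁ e₂

      p≡q : p ≡ q
      p≡q = δ-injective p∈ q∈
        (trans (∣-∣-balanced (f p₁) (f p₂) (f q₂) (f q₁) sums) (∣-∣-comm (f q₂) (f q₁)))

  sharedEdge⇒sameBlock : ∀ {w w′ u v} → BlockEdge Γ K (place w) u v → BlockEdge Γ K (place w′) u v → w ≡ w′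
  sharedEdge⇒sameBlock (p , p∈ , e) (q , q∈ , e′) with sameEdge-join e e′
  ... | inj₁ (e₁ , e₂) = straightImage p∈ q∈ e₁ e₂
  ... | inj₂ (e₁ , e₂) = ⊥-elim (crossedImage p∈ q∈ e₁ e₂)

  anchor : Fin (n Γ) → Fin N → Fin N
  anchor x v = rotate (N ∸ f x) v

  anchor-places : ∀ x v → place (anchor x v) x ≡ v
  anchor-places x v = rotate-cancel (m∸n+n≡m (<⇒≤ (label<N x))) v

  anchor-places-shifted : ∀ {k u v} x y → f y ≡ f x + k → rotate k v ≡ u → place (anchor x v) y ≡ u
  anchor-places-shifted {k} {u} {v} x y fy≡fx+k rkv≡u = begin
    rotate (f y) (anchor x v)               ≡⟨ cong (λ ℓ → rotate ℓ (anchor x v)) fy≡fx+k ⟩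
    rotate (f x + k) (anchor x v)           ≡⟨ rotate-rotate k (f x) (anchor x v) ⟨
    rotate k (place (anchor x v) x)         ≡⟨ cong (rotate k) (anchor-places x v) ⟩
    rotate k v                              ≡⟨ rkv≡u ⟩
    u                                       ∎
    where open ≡-Reasoning

  -- If rotating v by an admissible distance k gives u, the edge of Γ with
  -- distance k, anchored at v by its end with the smaller label, covers {u, v}.
  covered : ∀ {k u v} → k < D → k % c ≢ 0 → rotate k v ≡ u → ∃[ w ] BlockEdge Γ K (place w) u v
  covered {k} {u} {v} k<D k%c≢0 rkv≡u with (x , y) , p∈ , δp≡k ← edgeAt k<D k%c≢0
                                       with ∣-∣-orient (f x) (f y)
  ... | inj₁ fy≡fx+δ = anchor x v , (x , y) , p∈ ,
        inj₂ (anchor-places x v , anchor-places-shifted x y (trans fy≡fx+δ (cong (f x +_) δp≡k)) rkv≡u)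
  ... | inj₂ fx≡fy+δ = anchor y v , (x , y) , p∈ ,
        inj₁ (anchor-places-shifted y x (trans fx≡fy+δ (cong (f y +_) δp≡k)) rkv≡u , anchor-places y v)

  rotate-otherPart : ∀ {k u v} → rotate k v ≡ u → ¬ SamePart c b u v → k % c ≢ 0
  rotate-otherPart {k} {u} {v} rkv≡u different k%c≡0 = different
    (subst₂ (SamePart c b) rkv≡u (rotate-zero v)
      (Equivalence.from (rotate-samePart⇔ k 0 v) (trans k%c≡0 (sym 0%c≡0))))

  N∸D≡D : N ∸ D ≡ D
  N∸D≡D = trans (cong (_∸ D) (sym D+D≡N)) (m+n∸m≡n D D)

  -- Every edge {u, v} of K lies in some block: rotate v to u by k < N; k is not
  -- a multiple of c, so k ≠ D, and either k < D or u is rotated to v by N - k < D.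
  blockThrough : ∀ u v → ¬ SamePart c b u v → ∃[ w ] BlockEdge Γ K (place w) u v
  blockThrough u v different with k , k<N , rkv≡u ← rotate-reach v u with <-cmp k D
  ... | tri< k<D _ _ = covered k<D (rotate-otherPart rkv≡u different) rkv≡u
  ... | tri≈ _ k≡D _ = ⊥-elim (rotate-otherPart rkv≡u different (trans (cong (_% c) k≡D) (m*n%n≡0 d c)))
  ... | tri> _ _ D<k = map₂ (blockEdge-swap {Γ} {K}) (covered N∸k<D (rotate-otherPart back (different ∘ samePart-sym)) back)
    where
    back : rotate (N ∸ k) u ≡ v
    back = trans (cong (rotate (N ∸ k)) (sym rkv≡u)) (rotate-cancel (m+[n∸m]≡n (<⇒≤ k<N)) v)

    N∸k<D : N ∸ k < D
    N∸k<D = subst (N ∸ k <_) N∸D≡D (∸-monoʳ-< D<k (<⇒≤ k<N))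

  -- distinct translates are distinct blocks: Γ has an edge (d * m > 0), and its
  -- image in the block at w would also be an edge of the block at w′
  translates-distinct : ∀ w w′ → SameBlock Γ K (place w) (place w′) → w ≡ w′
  translates-distinct w w′ (_ , sameEdges) with p , p∈ , _ ← uncurry edgeAt (unrank-inTarget (>-nonZero⁻¹ (d * m) {{m*n≢0 d m}})) =
    sharedEdge⇒sameBlock own (Equivalence.to (sameEdges _ _) own)
    where
    own : BlockEdge Γ K (place w) (place w (proj₁ p)) (place w (proj₂ p))
    own = p , p∈ , inj₁ (refl , refl)

  decomposition : Decomposition Γ K
  decomposition = record
    { t              = N
    ; block          = blockAt
    ; partition      = λ u v different →
        let (w , through) = blockThrough u v different
        in w , through , λ w′ through′ → sharedEdge⇒sameBlock through′ through
    ; distinctBlocks = translates-distinct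
    }

  -- the one-step rotation commutes with the translates: σ ∘ place w ≡ place (σ w)
  cyclic : CyclicDecomposition Γ K
  cyclic = decomposition , σ , σ-fullCycle ,
           equivariant⇒automorphism decomposition σ σ (λ w x → rotate-comm 1 (f x) w)

-- For m = 0 the host graph K_{1×2d} has no edges, so the empty decomposition
-- with the rotation σ works; for m ≥ 1 the translates of the labelling do.
proposition2p4 : (Γ : Graph) (d m : ℕ) → 0 < d → size Γ ≡ d * m →
    GracefulLabeling d m Γ →
    CyclicDecomposition Γ (Kmulti (m + 1) (2 * d))
proposition2p4 Γ d zero    0<d _     _ =
  edgeless⇒cyclic (λ u v adjacent → adjacent (onePart (2 * d) u v)) σ σ-fullCycle
  where
  instance
    d≢0 : NonZero d
    d≢0 = >-nonZero 0<d
  open CyclicModel 1 (2 * d) {{_}} {{m*n≢0 2 d}}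
proposition2p4 Γ d (suc m) 0<d size≡ L = cyclic
  where open Construction Γ d (suc m) {{>-nonZero 0<d}} L size≡
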